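{- Let $L$ be an $n\times n$ M-matrix with integer entries. If $f\in\mathbb{Z}^n$ is $z$-superstable, then $D^L-f$ is a critical configuration.
   Context: An $n\times n$ real matrix $L$ is a Z-matrix if $L_{ij}\le 0$ for all $i\ne j$. A (non-singular) M-matrix is a Z-matrix $L$ that is invertible with $L^{ -1}$ entrywise non-negative; such a matrix has positive diagonal entries. Vector inequalities are entrywise, and $e_i$ denotes the $i$-th standard basis vector. A vector $f\in\mathbb{Z}^n$ with $f\ge0$ is $z$-superstable if for every $z\in\mathbb{Z}^n$ with $z\ge0$ and $z\ne0$ there is an $i$ with $f_i-(Lz)_i<0$. The vector $D^L\in\mathbb{Z}^n$ is defined by $D^L_i=L_{ii}-1$. A configuration $c\in\mathbb{Z}^n$ is stable if $c_i<L_{ii}$ for all $i$. A configuration $c$ is critical if it is stable and there exist $g\in\mathbb{Z}^n$ with $g_i\ge L_{ii}$ for all $i$ and indices $i_1,\dots,i_k\in\{1,\dots,n\}$ such that \[ c=g-\sum_{j=1}^k Le_{i_j} \] and, for every $\ell<k$, the $i_{\ell+1}$-th entry of $g-\sum_{j=1}^{\ell}Le_{i_j}$ is at least $L_{i_{\ell+1}i_{\ell+1}}$. -}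

module Defs where

open import Data.Nat using (ℕ)
open import Data.Fin using (Fin)
open import Data.Integer as ℤ using (ℤ; +_; _≤_; _<_; _-_)
open import Data.Rational as ℚ using (ℚ; 0ℚ; 1ℚ)
open import Data.Vec.Functional using (foldr)
open import Data.List using (List; []; _∷_)
open import Data.Product using (Σ; ∃; _×_; _,_)
open import Data.Sum using (_⊎_)
open import Relation.Binary.PropositionalEquality using (_≡_; _≢_)
open import Relation.Nullary using (¬_)
open import Data.Unit using (⊤)

Mat : ℕ → Set
Mat n = Fin n → Fin n → ℤ

Vecℤ : ℕ → Set
Vecℤ n = Fin n → ℤ

Σℤ : ∀ {n} → (Fin n → ℤ) → ℤ
Σℤ = foldr ℤ._+_ (+ 0)

Σℚ : ∀ {n} → (Fin n → ℚ) → ℚ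
Σℚ = foldr ℚ._+_ 0ℚ

_·_ : ∀ {n} → Mat n → Vecℤ n → Vecℤ n
(L · z) i = Σℤ (λ j → L i j ℤ.* z j)

e : ∀ {n} → Fin n → Vecℤ n
e i j with i Data.Fin.≟ j
... | Relation.Nullary.yes _ = + 1
... | Relation.Nullary.no _ = + 0

Idℚ : ∀ {n} → Fin n → Fin n → ℚ
Idℚ i j with i Data.Fin.≟ j
... | Relation.Nullary.yes _ = 1ℚ
... | Relation.Nullary.no _ = 0ℚ

IsZMatrix : ∀ {n} → Mat n → Set
IsZMatrix L = ∀ i j → i ≢ j → L i j ≤ + 0

-- L is invertible with entrywise non-negative inverse.  Since L has integer
-- (hence rational) entries, its real inverse (if any) has rational entries.
IsMMatrix : ∀ {n} → Mat n → Set
IsMMatrix {n} L = IsZMatrix L ×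
  Σ (Fin n → Fin n → ℚ) λ N →
    (∀ i j → Σℚ (λ k → ℚ._*_ (ℚ._/_ (L i k) 1) (N k j)) ≡ Idℚ i j) ×
    (∀ i j → Σℚ (λ k → ℚ._*_ (N i k) (ℚ._/_ (L k j) 1)) ≡ Idℚ i j) ×
    (∀ i j → 0ℚ ℚ.≤ N i j)

NonNeg : ∀ {n} → Vecℤ n → Set
NonNeg v = ∀ i → + 0 ≤ v i

ZSuperstable : ∀ {n} → Mat n → Vecℤ n → Set
ZSuperstable {n} L f = NonNeg f ×
  (∀ (z : Vecℤ n) → NonNeg z → ¬ (∀ i → z i ≡ + 0) →
     ∃ λ i → f i - (L · z) i < + 0)

D : ∀ {n} → Mat n → Vecℤ n
D L i = L i i - + 1

Stable : ∀ {n} → Mat n → Vecℤ n → Set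
Stable L c = ∀ i → c i < L i i

fire : ∀ {n} → Mat n → Vecℤ n → Fin n → Vecℤ n
fire L g i j = g j - (L · e i) j

Fire : ∀ {n} → Mat n → Vecℤ n → List (Fin n) → Vecℤ n
Fire L g [] = g
Fire L g (i ∷ is) = Fire L (fire L g i) is

Legal : ∀ {n} → Mat n → Vecℤ n → List (Fin n) → Set
Legal L g [] = ⊤
Legal L g (i ∷ is) = L i i ≤ g i × Legal L (fire L g i) is

Critical : ∀ {n} → Mat n → Vecℤ n → Set
Critical {n} L c = Stable L c ×
  Σ (Vecℤ n) λ g → Σ (List (Fin n)) λ is →
    (∀ i → L i i ≤ g i) × Legal L g is × (∀ j → c j ≡ Fire L g is j)

-- The rational vector N (f + 1) is
-- non-negative, and clearing its denominators gives an integer z ≥ 0 with L z ≥ f + 1, so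
-- the configuration c + L z, where c = D^L − f, has every entry g_i ≥ L_ii.  While z ≠ 0,
-- z-superstability yields i with f_i < (L z)_i; this makes i legal in c + L z and forces
-- z_i > 0, since off the support of z the Z-matrix signs give (L z)_i ≤ 0 ≤ f_i.  Firing i
-- turns c + L z into c + L (z − e_i), so induction on Σ z reaches c.

module Submission where

open import Defs
open import Data.Nat as ℕ using (ℕ; zero; suc)
open import Data.Fin using (Fin; zero; suc)
open import Data.Integer as ℤ using (ℤ; +_; _+_; _-_; _*_; _≤_; _<_)
import Data.Integer.Properties as ℤP
open import Data.Integer.Tactic.RingSolver using (solve-∀)
open import Data.Rational as ℚ using (ℚ; 0ℚ; _/_; ↥_; ↧_)
import Data.Rational.Properties as ℚP
open import Data.Rational.Unnormalised as ℚᵘ using (mkℚᵘ; *≡*; *≤*)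
import Data.Rational.Unnormalised.Properties as ℚᵘP
open import Data.Fin.Properties using (_≟_)
open import Data.List using (List; []; _∷_)
open import Data.Product using (Σ; _×_; _,_; proj₁; proj₂)
open import Data.Unit using (tt)
open import Function using (_∘_)
open import Relation.Binary.PropositionalEquality
open import Relation.Nullary using (yes; no; ¬_)
open import Algebra.Bundles using (CommutativeRing; CommutativeMonoid)
import Algebra.Properties.Semiring.Sum as SemiringSum
import Algebra.Properties.CommutativeSemigroup as CommSemigroupProperties

module ∑ℤ = SemiringSum ℤP.+-*-semiring
module ∑ℚ = SemiringSum (CommutativeRing.semiring ℚP.+-*-commutativeRing)
module *ℚ = CommSemigroupProperties
  (CommutativeMonoid.commutativeSemigroup (CommutativeRing.*-commutativeMonoid ℚP.+-*-commutativeRing))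

∑ℤ-nonNeg : ∀ {n} (a : Fin n → ℤ) → (∀ i → + 0 ≤ a i) → + 0 ≤ Σℤ a
∑ℤ-nonNeg {zero} a a≥0 = ℤP.≤-refl
∑ℤ-nonNeg {suc n} a a≥0 = ℤP.+-mono-≤ (a≥0 zero) (∑ℤ-nonNeg (a ∘ suc) (a≥0 ∘ suc))

∑ℤ-nonPos : ∀ {n} (a : Fin n → ℤ) → (∀ i → a i ≤ + 0) → Σℤ a ≤ + 0
∑ℤ-nonPos {zero} a a≤0 = ℤP.≤-refl
∑ℤ-nonPos {suc n} a a≤0 = ℤP.+-mono-≤ (a≤0 zero) (∑ℤ-nonPos (a ∘ suc) (a≤0 ∘ suc))

∑ℚ-nonNeg : ∀ {n} (a : Fin n → ℚ) → (∀ i → 0ℚ ℚ.≤ a i) → 0ℚ ℚ.≤ Σℚ a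
∑ℚ-nonNeg {zero} a a≥0 = ℚP.≤-refl
∑ℚ-nonNeg {suc n} a a≥0 = ℚP.+-mono-≤ (a≥0 zero) (∑ℚ-nonNeg (a ∘ suc) (a≥0 ∘ suc))

ℚ-*-nonNeg : ∀ {p q} → 0ℚ ℚ.≤ p → 0ℚ ℚ.≤ q → 0ℚ ℚ.≤ p ℚ.* q
ℚ-*-nonNeg {p} {q} p≥0 q≥0 = ℚP.nonNegative⁻¹ (p ℚ.* q)
  {{ℚP.nonNeg*nonNeg⇒nonNeg p {{ℚ.nonNegative p≥0}} q {{ℚ.nonNegative q≥0}}}}

∑ℤ-nonNeg-≡0 : ∀ {n} (a : Fin n → ℤ) → (∀ i → + 0 ≤ a i) → Σℤ a ≡ + 0 → ∀ i → a i ≡ + 0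
∑ℤ-nonNeg-≡0 {suc n} a a≥0 ∑a≡0 = λ where
    zero → a₀≡0
    (suc i) → ∑ℤ-nonNeg-≡0 (a ∘ suc) (a≥0 ∘ suc) ∑tail≡0 i
  where
  ∑tail≥0 = ∑ℤ-nonNeg (a ∘ suc) (a≥0 ∘ suc)
  a₀≡0 : a zero ≡ + 0
  a₀≡0 = ℤP.≤-antisym (subst (a zero ≤_) ∑a≡0 (ℤP.i≤i+j (a zero) _ {{ℤ.nonNegative ∑tail≥0}})) (a≥0 zero)
  ∑tail≡0 : Σℤ (a ∘ suc) ≡ + 0
  ∑tail≡0 = trans (sym (ℤP.+-identityˡ _)) (trans (cong (_+ Σℤ (a ∘ suc)) (sym a₀≡0)) ∑a≡0)

∑ℤ-e : ∀ {n} (i : Fin n) → Σℤ (e i) ≡ + 1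
∑ℤ-e {suc n} zero = cong (_+_ (+ 1)) (∑ℤ.sum-replicate-zero n)
∑ℤ-e {suc n} (suc i) = trans (ℤP.+-identityˡ _) (trans (∑ℤ.sum-cong-≗ (e-suc i)) (∑ℤ-e i))
  where
  e-suc : ∀ {n} (i : Fin n) j → e (suc i) (suc j) ≡ e i j
  e-suc i j with i ≟ j
  ... | yes _ = refl
  ... | no _ = refl

∑ℚ-Idℚ : ∀ {n} (i : Fin n) (x : Fin n → ℚ) → Σℚ (λ j → Idℚ i j ℚ.* x j) ≡ x i
∑ℚ-Idℚ {suc n} zero x = begin
  ℚ.1ℚ ℚ.* x zero ℚ.+ Σℚ (λ j → 0ℚ ℚ.* x (suc j))  ≡⟨ cong₂ ℚ._+_ (ℚP.*-identityˡ (x zero)) ∑0≡0 ⟩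
  x zero ℚ.+ 0ℚ                                     ≡⟨ ℚP.+-identityʳ (x zero) ⟩
  x zero                                            ∎
  where
  open ≡-Reasoning
  ∑0≡0 = trans (∑ℚ.sum-cong-≗ (ℚP.*-zeroˡ ∘ x ∘ suc)) (∑ℚ.sum-replicate-zero n)
∑ℚ-Idℚ {suc n} (suc i) x = begin
  0ℚ ℚ.* x zero ℚ.+ Σℚ (λ j → Idℚ (suc i) (suc j) ℚ.* x (suc j))  ≡⟨ cong₂ ℚ._+_ (ℚP.*-zeroˡ (x zero)) ∑-suc ⟩
  0ℚ ℚ.+ Σℚ (λ j → Idℚ i j ℚ.* x (suc j))                         ≡⟨ ℚP.+-identityˡ _ ⟩
  Σℚ (λ j → Idℚ i j ℚ.* x (suc j))                                ≡⟨ ∑ℚ-Idℚ i (x ∘ suc) ⟩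
  x (suc i)                                                       ∎
  where
  open ≡-Reasoning
  Idℚ-suc : ∀ j → Idℚ (suc i) (suc j) ≡ Idℚ i j
  Idℚ-suc j with i ≟ j
  ... | yes _ = refl
  ... | no _ = refl
  ∑-suc = ∑ℚ.sum-cong-≗ λ j → cong (ℚ._* x (suc j)) (Idℚ-suc j)

toℚ : ℤ → ℚ
toℚ a = a / 1

toℚᵘ-toℚ : ∀ a → ℚ.toℚᵘ (toℚ a) ℚᵘ.≃ mkℚᵘ a 0
toℚᵘ-toℚ a = ℚP.toℚᵘ-fromℚᵘ (mkℚᵘ a 0)

toℚ-homo-+ : ∀ a b → toℚ (a + b) ≡ toℚ a ℚ.+ toℚ b
toℚ-homo-+ a b = ℚP.toℚᵘ-injective (begin
  ℚ.toℚᵘ (toℚ (a + b))                 ≈⟨ toℚᵘ-toℚ (a + b) ⟩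
  mkℚᵘ (a + b) 0                        ≈⟨ *≡* (lemma a b) ⟩
  mkℚᵘ a 0 ℚᵘ.+ mkℚᵘ b 0                ≈⟨ ℚᵘP.+-cong (toℚᵘ-toℚ a) (toℚᵘ-toℚ b) ⟨
  ℚ.toℚᵘ (toℚ a) ℚᵘ.+ ℚ.toℚᵘ (toℚ b)    ≈⟨ ℚP.toℚᵘ-homo-+ (toℚ a) (toℚ b) ⟨
  ℚ.toℚᵘ (toℚ a ℚ.+ toℚ b)              ∎)
  where
  open ℚᵘP.≃-Reasoning
  lemma : ∀ a b → (a + b) * + 1 ≡ (a * + 1 + b * + 1) * + 1
  lemma = solve-∀

toℚ-homo-* : ∀ a b → toℚ (a * b) ≡ toℚ a ℚ.* toℚ b
toℚ-homo-* a b = ℚP.toℚᵘ-injective (begin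
  ℚ.toℚᵘ (toℚ (a * b))                 ≈⟨ toℚᵘ-toℚ (a * b) ⟩
  mkℚᵘ (a * b) 0                        ≈⟨ *≡* refl ⟩
  mkℚᵘ a 0 ℚᵘ.* mkℚᵘ b 0                ≈⟨ ℚᵘP.*-cong (toℚᵘ-toℚ a) (toℚᵘ-toℚ b) ⟨
  ℚ.toℚᵘ (toℚ a) ℚᵘ.* ℚ.toℚᵘ (toℚ b)    ≈⟨ ℚP.toℚᵘ-homo-* (toℚ a) (toℚ b) ⟨
  ℚ.toℚᵘ (toℚ a ℚ.* toℚ b)              ∎)
  where open ℚᵘP.≃-Reasoning

toℚ-cancel-≤ : ∀ {a b} → toℚ a ℚ.≤ toℚ b → a ≤ b
toℚ-cancel-≤ {a} {b} le with ℚᵘP.≤-respʳ-≃ (toℚᵘ-toℚ b) (ℚᵘP.≤-respˡ-≃ (toℚᵘ-toℚ a) (ℚP.toℚᵘ-mono-≤ le))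
... | *≤* a*1≤b*1 = subst₂ _≤_ (ℤP.*-identityʳ a) (ℤP.*-identityʳ b) a*1≤b*1

toℚ-mono-≤ : ∀ {a b} → a ≤ b → toℚ a ℚ.≤ toℚ b
toℚ-mono-≤ {a} {b} le = ℚP.toℚᵘ-cancel-≤
  (ℚᵘP.≤-respʳ-≃ (ℚᵘP.≃-sym (toℚᵘ-toℚ b)) (ℚᵘP.≤-respˡ-≃ (ℚᵘP.≃-sym (toℚᵘ-toℚ a))
    (*≤* (subst₂ _≤_ (sym (ℤP.*-identityʳ a)) (sym (ℤP.*-identityʳ b)) le))))

toℚ-injective : ∀ {a b} → toℚ a ≡ toℚ b → a ≡ b
toℚ-injective eq = ℤP.≤-antisym (toℚ-cancel-≤ (ℚP.≤-reflexive eq)) (toℚ-cancel-≤ (ℚP.≤-reflexive (sym eq)))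

toℚ-homo-∑ : ∀ {n} (a : Fin n → ℤ) → toℚ (Σℤ a) ≡ Σℚ (toℚ ∘ a)
toℚ-homo-∑ {zero} a = refl
toℚ-homo-∑ {suc n} a = trans (toℚ-homo-+ (a zero) _) (cong (toℚ (a zero) ℚ.+_) (toℚ-homo-∑ (a ∘ suc)))

toℚ-↥ : ∀ q → toℚ (↥ q) ≡ toℚ (↧ q) ℚ.* q
toℚ-↥ q@record{} = ℚP.toℚᵘ-injective (begin
  ℚ.toℚᵘ (toℚ (↥ q))                          ≈⟨ toℚᵘ-toℚ (↥ q) ⟩
  mkℚᵘ (↥ q) 0                                 ≈⟨ *≡* (lemma (↥ q) (↧ q)) ⟩
  mkℚᵘ (↧ q) 0 ℚᵘ.* ℚ.toℚᵘ q                   ≈⟨ ℚᵘP.*-congʳ (toℚᵘ-toℚ (↧ q)) ⟨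
  ℚ.toℚᵘ (toℚ (↧ q)) ℚᵘ.* ℚ.toℚᵘ q             ≈⟨ ℚP.toℚᵘ-homo-* (toℚ (↧ q)) q ⟨
  ℚ.toℚᵘ (toℚ (↧ q) ℚ.* q)                     ∎)
  where
  open ℚᵘP.≃-Reasoning
  lemma : ∀ x y → x * (+ 1 * y) ≡ (y * x) * + 1
  lemma = solve-∀

commonDenominator : ∀ {n} (w : Fin n → ℚ) →
  Σ ℕ λ d → Σ (Fin n → ℤ) λ z → ∀ k → toℚ (z k) ≡ toℚ (+ suc d) ℚ.* w k
commonDenominator {zero} w = 0 , (λ ()) , λ ()
commonDenominator {suc n} w with commonDenominator (w ∘ suc)
... | d' , z' , toℚ-z' = d , z , toℚ-z
  where
  q = w zero
  d = d' ℕ.+ ℚ.denominator-1 q ℕ.* suc d'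
  toℚ-suc-d : toℚ (+ suc d) ≡ toℚ (↧ q) ℚ.* toℚ (+ suc d')
  toℚ-suc-d = trans (cong toℚ (ℤP.pos-* (suc (ℚ.denominator-1 q)) (suc d'))) (toℚ-homo-* (↧ q) (+ suc d'))
  z : Fin (suc n) → ℤ
  z zero = ↥ q * + suc d'
  z (suc k) = z' k * ↧ q
  toℚ-z : ∀ k → toℚ (z k) ≡ toℚ (+ suc d) ℚ.* w k
  toℚ-z zero = begin
    toℚ (↥ q * + suc d')                          ≡⟨ toℚ-homo-* (↥ q) (+ suc d') ⟩
    toℚ (↥ q) ℚ.* toℚ (+ suc d')                  ≡⟨ cong (ℚ._* toℚ (+ suc d')) (toℚ-↥ q) ⟩
    (toℚ (↧ q) ℚ.* q) ℚ.* toℚ (+ suc d')          ≡⟨ *ℚ.xy∙z≈xz∙y (toℚ (↧ q)) q (toℚ (+ suc d')) ⟩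
    (toℚ (↧ q) ℚ.* toℚ (+ suc d')) ℚ.* q          ≡⟨ cong (ℚ._* q) toℚ-suc-d ⟨
    toℚ (+ suc d) ℚ.* q                           ∎
    where open ≡-Reasoning
  toℚ-z (suc k) = begin
    toℚ (z' k * ↧ q)                               ≡⟨ toℚ-homo-* (z' k) (↧ q) ⟩
    toℚ (z' k) ℚ.* toℚ (↧ q)                       ≡⟨ cong (ℚ._* toℚ (↧ q)) (toℚ-z' k) ⟩
    (toℚ (+ suc d') ℚ.* w (suc k)) ℚ.* toℚ (↧ q)   ≡⟨ *ℚ.xy∙z≈zx∙y (toℚ (+ suc d')) (w (suc k)) (toℚ (↧ q)) ⟩
    (toℚ (↧ q) ℚ.* toℚ (+ suc d')) ℚ.* w (suc k)   ≡⟨ cong (ℚ._* w (suc k)) toℚ-suc-d ⟨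
    toℚ (+ suc d) ℚ.* w (suc k)                    ∎
    where open ≡-Reasoning

infixr 7 _·ℚ_

_·ℚ_ : ∀ {n} → (Fin n → Fin n → ℚ) → (Fin n → ℚ) → Fin n → ℚ
(A ·ℚ x) i = Σℚ (λ k → A i k ℚ.* x k)

toℚ-homo-· : ∀ {n} (L : Mat n) (z : Vecℤ n) i → toℚ ((L · z) i) ≡ ((λ i k → toℚ (L i k)) ·ℚ (toℚ ∘ z)) i
toℚ-homo-· L z i = trans (toℚ-homo-∑ (λ k → L i k * z k)) (∑ℚ.sum-cong-≗ λ k → toℚ-homo-* (L i k) (z k))

·ℚ-*ˡ : ∀ {n} (A : Fin n → Fin n → ℚ) c x i → (A ·ℚ (λ k → c ℚ.* x k)) i ≡ c ℚ.* (A ·ℚ x) i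
·ℚ-*ˡ A c x i = trans (∑ℚ.sum-cong-≗ λ k → *ℚ.x∙yz≈y∙xz (A i k) c (x k))
  (sym (∑ℚ.*-distribˡ-sum c λ k → A i k ℚ.* x k))

·ℚ-rightInverse : ∀ {n} (A B : Fin n → Fin n → ℚ) → (∀ i j → Σℚ (λ k → A i k ℚ.* B k j) ≡ Idℚ i j) →
  ∀ x i → (A ·ℚ B ·ℚ x) i ≡ x i
·ℚ-rightInverse A B AB≡I x i = begin
  Σℚ (λ k → A i k ℚ.* Σℚ (λ j → B k j ℚ.* x j))
    ≡⟨ ∑ℚ.sum-cong-≗ (λ k → ∑ℚ.*-distribˡ-sum (A i k) λ j → B k j ℚ.* x j) ⟩
  Σℚ (λ k → Σℚ (λ j → A i k ℚ.* (B k j ℚ.* x j)))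
    ≡⟨ ∑ℚ.∑-comm (λ k j → A i k ℚ.* (B k j ℚ.* x j)) ⟩
  Σℚ (λ j → Σℚ (λ k → A i k ℚ.* (B k j ℚ.* x j)))
    ≡⟨ ∑ℚ.sum-cong-≗ (λ j → ∑ℚ.sum-cong-≗ λ k → sym (ℚP.*-assoc (A i k) (B k j) (x j))) ⟩
  Σℚ (λ j → Σℚ (λ k → (A i k ℚ.* B k j) ℚ.* x j))
    ≡⟨ ∑ℚ.sum-cong-≗ (λ j → ∑ℚ.*-distribʳ-sum (x j) λ k → A i k ℚ.* B k j) ⟨
  Σℚ (λ j → Σℚ (λ k → A i k ℚ.* B k j) ℚ.* x j)
    ≡⟨ ∑ℚ.sum-cong-≗ (λ j → cong (ℚ._* x j) (AB≡I i j)) ⟩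
  Σℚ (λ j → Idℚ i j ℚ.* x j)
    ≡⟨ ∑ℚ-Idℚ i x ⟩
  x i ∎
  where open ≡-Reasoning

nonNegRightInverse⇒dominating : ∀ {n} (L : Mat n) (N : Fin n → Fin n → ℚ) →
  (∀ i j → Σℚ (λ k → toℚ (L i k) ℚ.* N k j) ≡ Idℚ i j) → (∀ i j → 0ℚ ℚ.≤ N i j) →
  (v : Vecℤ n) → NonNeg v → Σ (Vecℤ n) λ z → NonNeg z × (∀ i → v i ≤ (L · z) i)
nonNegRightInverse⇒dominating L N LN≡I N≥0 v v≥0 = z , z≥0 , v≤Lz
  where
  w = N ·ℚ (toℚ ∘ v)
  den = commonDenominator w
  d = proj₁ den
  z = proj₁ (proj₂ den)
  toℚ-z = proj₂ (proj₂ den)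
  d≥0 : 0ℚ ℚ.≤ toℚ (+ suc d)
  d≥0 = toℚ-mono-≤ {+ 0} {+ suc d} (ℤ.+≤+ ℕ.z≤n)
  w≥0 : ∀ k → 0ℚ ℚ.≤ w k
  w≥0 k = ∑ℚ-nonNeg _ λ j → ℚ-*-nonNeg (N≥0 k j) (toℚ-mono-≤ (v≥0 j))
  z≥0 : NonNeg z
  z≥0 k = toℚ-cancel-≤ (subst (0ℚ ℚ.≤_) (sym (toℚ-z k)) (ℚ-*-nonNeg d≥0 (w≥0 k)))
  Lz≡dv : ∀ i → (L · z) i ≡ + suc d * v i
  Lz≡dv i = toℚ-injective (begin
    toℚ ((L · z) i)                                   ≡⟨ toℚ-homo-· L z i ⟩
    (Lℚ ·ℚ (toℚ ∘ z)) i                              ≡⟨ ∑ℚ.sum-cong-≗ (λ k → cong (Lℚ i k ℚ.*_) (toℚ-z k)) ⟩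
    (Lℚ ·ℚ (λ k → toℚ (+ suc d) ℚ.* w k)) i          ≡⟨ ·ℚ-*ˡ Lℚ (toℚ (+ suc d)) w i ⟩
    toℚ (+ suc d) ℚ.* (Lℚ ·ℚ w) i                    ≡⟨ cong (toℚ (+ suc d) ℚ.*_) (·ℚ-rightInverse Lℚ N LN≡I (toℚ ∘ v) i) ⟩
    toℚ (+ suc d) ℚ.* toℚ (v i)                      ≡⟨ toℚ-homo-* (+ suc d) (v i) ⟨
    toℚ (+ suc d * v i)                               ∎)
    where
    open ≡-Reasoning
    Lℚ = λ i k → toℚ (L i k)
  v≤Lz : ∀ i → v i ≤ (L · z) i
  v≤Lz i = subst₂ _≤_ (ℤP.*-identityˡ (v i)) (sym (Lz≡dv i))
    (ℤP.*-monoʳ-≤-nonNeg (v i) {{ℤ.nonNegative (v≥0 i)}} {+ 1} {+ suc d} (ℤ.+≤+ (ℕ.s≤s ℕ.z≤n)))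

infixl 6 _+ᵥ_ _-ᵥ_

_+ᵥ_ _-ᵥ_ : ∀ {n} → Vecℤ n → Vecℤ n → Vecℤ n
(x +ᵥ y) j = x j + y j
(x -ᵥ y) j = x j - y j

·-distrib-+ᵥ : ∀ {n} (L : Mat n) x y j → (L · (x +ᵥ y)) j ≡ (L · x) j + (L · y) j
·-distrib-+ᵥ L x y j = trans (∑ℤ.sum-cong-≗ λ k → ℤP.*-distribˡ-+ (L j k) (x k) (y k))
  (∑ℤ.∑-distrib-+ (λ k → L j k * x k) (λ k → L j k * y k))

·-zero : ∀ {n} (L : Mat n) z → (∀ k → z k ≡ + 0) → ∀ j → (L · z) j ≡ + 0
·-zero {n} L z z≡0 j = trans (∑ℤ.sum-cong-≗ λ k → trans (cong (L j k *_) (z≡0 k)) (ℤP.*-zeroʳ (L j k)))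
  (∑ℤ.sum-replicate-zero n)

-ᵥe+ᵥe : ∀ {n} (z : Vecℤ n) i j → z j ≡ ((z -ᵥ e i) +ᵥ e i) j
-ᵥe+ᵥe z i j = lemma (z j) (e i j)
  where
  lemma : ∀ a b → a ≡ (a - b) + b
  lemma = solve-∀

∑-ᵥe : ∀ {n} (z : Vecℤ n) i k → Σℤ z ≡ + suc k → Σℤ (z -ᵥ e i) ≡ + k
∑-ᵥe z i k ∑z≡1+k = begin
  Σℤ (z -ᵥ e i)                      ≡⟨ lemma (Σℤ (z -ᵥ e i)) ⟩
  (Σℤ (z -ᵥ e i) + + 1) - + 1        ≡⟨ cong (λ s → (Σℤ (z -ᵥ e i) + s) - + 1) (∑ℤ-e i) ⟨
  (Σℤ (z -ᵥ e i) + Σℤ (e i)) - + 1   ≡⟨ cong (_- + 1) (∑ℤ.∑-distrib-+ (z -ᵥ e i) (e i)) ⟨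
  Σℤ ((z -ᵥ e i) +ᵥ e i) - + 1       ≡⟨ cong (_- + 1) (∑ℤ.sum-cong-≗ (-ᵥe+ᵥe z i)) ⟨
  Σℤ z - + 1                         ≡⟨ cong (_- + 1) ∑z≡1+k ⟩
  + k                                ∎
  where
  open ≡-Reasoning
  lemma : ∀ s → s ≡ (s + + 1) - + 1
  lemma = solve-∀

-ᵥe-nonNeg : ∀ {n} (z : Vecℤ n) i → NonNeg z → + 1 ≤ z i → NonNeg (z -ᵥ e i)
-ᵥe-nonNeg z i z≥0 zᵢ≥1 j with i ≟ j
... | yes refl = ℤP.i≤j⇒0≤j-i zᵢ≥1
... | no _ = subst (+ 0 ≤_) (sym (ℤP.+-identityʳ (z j))) (z≥0 j)

fire-+ᵥ· : ∀ {n} (L : Mat n) (x z g : Vecℤ n) i → (∀ j → g j ≡ (x +ᵥ L · z) j) →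
  ∀ j → fire L g i j ≡ (x +ᵥ L · (z -ᵥ e i)) j
fire-+ᵥ· L x z g i g≡x+Lz j = begin
  g j - Leᵢ                                            ≡⟨ cong (_- Leᵢ) (g≡x+Lz j) ⟩
  x j + (L · z) j - Leᵢ                                ≡⟨ cong (λ y → x j + y - Leᵢ) Lz≡ ⟩
  x j + ((L · (z -ᵥ e i)) j + Leᵢ) - Leᵢ               ≡⟨ lemma (x j) _ _ ⟩
  x j + (L · (z -ᵥ e i)) j                             ∎
  where
  open ≡-Reasoning
  Leᵢ = (L · e i) j
  Lz≡ : (L · z) j ≡ (L · (z -ᵥ e i)) j + Leᵢ
  Lz≡ = trans (∑ℤ.sum-cong-≗ λ k → cong (L j k *_) (-ᵥe+ᵥe z i k)) (·-distrib-+ᵥ L (z -ᵥ e i) (e i) j)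
  lemma : ∀ a b c → a + (b + c) - c ≡ a + b
  lemma = solve-∀

zMatrix-·-offSupport : ∀ {n} (L : Mat n) → IsZMatrix L → (z : Vecℤ n) → NonNeg z →
  ∀ i → z i ≡ + 0 → (L · z) i ≤ + 0
zMatrix-·-offSupport L isZ z z≥0 i zᵢ≡0 = ∑ℤ-nonPos _ term≤0
  where
  term≤0 : ∀ k → L i k * z k ≤ + 0
  term≤0 k with i ≟ k
  ... | yes refl = ℤP.≤-reflexive (trans (cong (L i i *_) zᵢ≡0) (ℤP.*-zeroʳ (L i i)))
  ... | no i≢k = subst (L i k * z k ≤_) (ℤP.*-zeroˡ (z k))
        (ℤP.*-monoʳ-≤-nonNeg (z k) {{ℤ.nonNegative (z≥0 k)}} (isZ i k i≢k))

FiresTo : ∀ {n} → Mat n → Vecℤ n → Vecℤ n → Set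
FiresTo {n} L g c = Σ (List (Fin n)) λ is → Legal L g is × (∀ j → c j ≡ Fire L g is j)

module Superstable {n} (L : Mat n) (isZ : IsZMatrix L) (f : Vecℤ n) (superstable : ZSuperstable L f) where

  c : Vecℤ n
  c = D L -ᵥ f

  c-stable : Stable L c
  c-stable i = ℤP.suc[i]≤j⇒i<j (subst (ℤ.suc (c i) ≤_) (lemma (L i i) (f i))
                                   (ℤP.i≤i+j (ℤ.suc (c i)) (f i) {{ℤ.nonNegative (proj₁ superstable i)}}))
    where
    lemma : ∀ a b → + 1 + ((a - + 1) - b) + b ≡ a
    lemma = solve-∀

  diag≤c+ : ∀ i {x} → f i < x → L i i ≤ c i + x
  diag≤c+ i {x} fᵢ<x = subst (_≤ c i + x) (lemma (L i i) (f i))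
    (ℤP.+-monoʳ-≤ (c i) (ℤP.i<j⇒suc[i]≤j fᵢ<x))
    where
    lemma : ∀ a b → (a - + 1) - b + (+ 1 + b) ≡ a
    lemma = solve-∀

  firable : ∀ (z : Vecℤ n) → NonNeg z → ¬ (∀ i → z i ≡ + 0) →
    Σ (Fin n) λ i → + 1 ≤ z i × L i i ≤ c i + (L · z) i
  firable z z≥0 z≢0 with proj₂ superstable z z≥0 z≢0
  ... | i , fᵢ-Lzᵢ<0 = i , zᵢ≥1 , diag≤c+ i fᵢ<Lzᵢ
    where
    fᵢ<Lzᵢ : f i < (L · z) i
    fᵢ<Lzᵢ = subst₂ _<_ (lemma (f i) ((L · z) i)) (ℤP.+-identityˡ ((L · z) i))
      (ℤP.+-monoˡ-< ((L · z) i) fᵢ-Lzᵢ<0)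
      where
      lemma : ∀ a b → (a - b) + b ≡ a
      lemma = solve-∀
    zᵢ≢0 : z i ≢ + 0
    zᵢ≢0 zᵢ≡0 = ℤP.<⇒≱ fᵢ<Lzᵢ
      (ℤP.≤-trans (zMatrix-·-offSupport L isZ z z≥0 i zᵢ≡0) (proj₁ superstable i))
    zᵢ≥1 : + 1 ≤ z i
    zᵢ≥1 = ℤP.i<j⇒suc[i]≤j (ℤP.≤∧≢⇒< (z≥0 i) (zᵢ≢0 ∘ sym))

  relax : ∀ k (z : Vecℤ n) → NonNeg z → Σℤ z ≡ + k → ∀ g → (∀ j → g j ≡ (c +ᵥ L · z) j) → FiresTo L g c
  relax zero z z≥0 ∑z≡0 g g≡c+Lz = [] , tt , λ j → sym (begin
    g j             ≡⟨ g≡c+Lz j ⟩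
    c j + (L · z) j ≡⟨ cong (_+_ (c j)) (·-zero L z (∑ℤ-nonNeg-≡0 z z≥0 ∑z≡0) j) ⟩
    c j + + 0       ≡⟨ ℤP.+-identityʳ (c j) ⟩
    c j             ∎)
    where open ≡-Reasoning
  relax (suc k) z z≥0 ∑z≡1+k g g≡c+Lz with firable z z≥0 z≢0
    where
    z≢0 : ¬ (∀ i → z i ≡ + 0)
    z≢0 z≡0 with trans (sym ∑z≡1+k) (trans (∑ℤ.sum-cong-≗ z≡0) (∑ℤ.sum-replicate-zero n))
    ... | ()
  ... | i , zᵢ≥1 , diag≤gᵢ =
    let is , legal , fires = relax k (z -ᵥ e i) (-ᵥe-nonNeg z i z≥0 zᵢ≥1) (∑-ᵥe z i k ∑z≡1+k)
                               (fire L g i) (fire-+ᵥ· L c z g i g≡c+Lz)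
    in i ∷ is , (subst (L i i ≤_) (sym (g≡c+Lz i)) diag≤gᵢ , legal) , fires

theorem4p14 : (n : ℕ) (L : Mat n) → IsMMatrix L → (f : Vecℤ n) →
    ZSuperstable L f → Critical L (λ i → D L i - f i)
theorem4p14 n L (isZ , N , LN≡I , _ , N≥0) f superstable@(f≥0 , _) =
  c-stable , c +ᵥ L · z , is , diag≤c+Lz , legal , fires
  where
  open Superstable L isZ f superstable
  dominating = nonNegRightInverse⇒dominating L N LN≡I N≥0 (ℤ.suc ∘ f)
    (λ i → ℤP.≤-trans (f≥0 i) (ℤP.i≤suc[i] (f i)))
  z = proj₁ dominating
  z≥0 = proj₁ (proj₂ dominating)
  diag≤c+Lz : ∀ i → L i i ≤ c i + (L · z) i
  diag≤c+Lz i = diag≤c+ i (ℤP.suc[i]≤j⇒i<j (proj₂ (proj₂ dominating) i))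
  fired = relax ℤ.∣ Σℤ z ∣ z z≥0 (sym (ℤP.0≤i⇒+∣i∣≡i (∑ℤ-nonNeg z z≥0)))
    (c +ᵥ L · z) (λ _ → refl)
  is = proj₁ fired
  legal = proj₁ (proj₂ fired)
  fires = proj₂ (proj₂ fired)
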